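{- Let $\mathbf{C}$ be a convex biproduct category. Then for all objects $X,Y$, all arrows $f,g\colon X\to Y$ and all $p\in[0,1]$, $$f+_p g=\langle f,g\rangle_{p,1-p};[\mathrm{id}_Y,\mathrm{id}_Y],$$ where $\langle f,g\rangle_{p,1-p}\colon X\to Y\oplus Y$ is the unique arrow $h$ with $h;\pi_1=p\cdot f$ and $h;\pi_2=(1-p)\cdot g$, and $[\mathrm{id}_Y,\mathrm{id}_Y]\colon Y\oplus Y\to Y$ is the copairing of identities.
   Context: Composition is written diagrammatically: $f;g$ means first $f$ then $g$. A pointed convex algebra (pca) is a set $X$ with an element $\star$ and binary operations $+_p$ for $p\in(0,1)$ such that for all $x_1,x_2,x_3$: $(x_1+_q x_2)+_p x_3=x_1+_{pq}(x_2+_{\tilde q}x_3)$ with $\tilde q=\frac{p(1-q)}{1-pq}$; $x_1+_p x_2=x_2+_{1-p}x_1$; $x+_p x=x$. One sets $x+_1y=x$, $x+_0 y=y$, and $p\cdot x:=x+_p\star$ for $p\in[0,1]$. A category is PCA-enriched if every hom-set is a pca and $e;(f+_pg)=(e;f)+_p(e;g)$, $(f+_pg);h=(f;h)+_p(g;h)$, $f;\star=\star=\star;f$. A convex product of $X_1,X_2$ is an object $Z$ with arrows $\pi_i\colon Z\to X_i$ such that for all $p_1,p_2\in[0,1]$ with $p_1+p_2\le 1$ and all $f_i\colon A\to X_i$ there is a unique $h\colon A\to Z$ with $h;\pi_i=p_i\cdot f_i$ ($i=1,2$); it is written $\langle f_1,f_2\rangle_{p_1,p_2}$. A convex biproduct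 category is a PCA-enriched category with an object $0$ that is both initial and terminal and, for every pair $X_1,X_2$, an object $X_1\oplus X_2$ with arrows $\pi_i\colon X_1\oplus X_2\to X_i$ and $\iota_i\colon X_i\to X_1\oplus X_2$ such that $(X_1\oplus X_2,\iota_1,\iota_2)$ is a coproduct, $(X_1\oplus X_2,\pi_1,\pi_2)$ is a convex product, and $\iota_i;\pi_j=\mathrm{id}_{X_i}$ if $i=j$ and $\iota_i;\pi_j=\star$ otherwise. $[f,g]$ denotes coproduct copairing. -}

module Defs where

open import Level using (Level; 0ℓ; _⊔_) renaming (suc to lsuc)
open import Data.Product using (Σ; ∃; _×_; _,_; proj₁; proj₂)
open import Data.Sum using (_⊎_; inj₁; inj₂)
open import Relation.Binary.Core using (Rel)
open import Relation.Binary.Structures using (IsStrictTotalOrder)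
open import Relation.Binary.PropositionalEquality
  using (_≡_; _≢_; refl; sym; trans; cong; subst; subst₂)
open import Algebra.Structures using (IsCommutativeRing)

-- The real numbers, axiomatised as a complete ordered field
-- (any model; all models are isomorphic).  Equality is _≡_.

record RealNumbers : Set₁ where
  infixl 6 _+_
  infixl 7 _*_
  infix 8 -_
  infix 4 _<_
  field
    ℝ   : Set
    _+_ : ℝ → ℝ → ℝ
    _*_ : ℝ → ℝ → ℝ
    -_  : ℝ → ℝ
    0ℝ  : ℝ
    1ℝ  : ℝ
    _<_ : Rel ℝ 0ℓ
    isCommutativeRing  : IsCommutativeRing _≡_ _+_ _*_ -_ 0ℝ 1ℝ
    0≢1                : 0ℝ ≢ 1ℝ
    inverse            : ∀ x → x ≢ 0ℝ → ∃ λ y → x * y ≡ 1ℝ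
    isStrictTotalOrder : IsStrictTotalOrder _≡_ _<_
    +-monoˡ-<          : ∀ {x y} z → x < y → x + z < y + z
    *-pos              : ∀ {x y} → 0ℝ < x → 0ℝ < y → 0ℝ < x * y
    sup : (S : ℝ → Set) → (∃ λ x → S x) →
          (∃ λ b → ∀ x → S x → (x < b ⊎ x ≡ b)) →
          ∃ λ s → (∀ x → S x → (x < s ⊎ x ≡ s))
                × (∀ b → (∀ x → S x → (x < b ⊎ x ≡ b)) → (s < b ⊎ s ≡ b))

  infix 4 _≤_
  _≤_ : ℝ → ℝ → Set
  x ≤ y = x < y ⊎ x ≡ y

  infixl 6 _-_
  _-_ : ℝ → ℝ → ℝ
  x - y = x + (- y)

  open IsCommutativeRing isCommutativeRing using
    (+-comm; +-assoc; +-identityˡ; +-identityʳ; -‿inverseʳ)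

  p+[1-p]≡1 : ∀ p → p + (1ℝ - p) ≡ 1ℝ
  p+[1-p]≡1 p =
    trans (cong (p +_) (+-comm 1ℝ (- p)))
   (trans (sym (+-assoc p (- p) 1ℝ))
   (trans (cong (_+ 1ℝ) (-‿inverseʳ p)) (+-identityˡ 1ℝ)))

  -0≡0 : - 0ℝ ≡ 0ℝ
  -0≡0 = trans (sym (+-identityˡ (- 0ℝ))) (-‿inverseʳ 0ℝ)

  0≤1-p : ∀ {p} → p ≤ 1ℝ → 0ℝ ≤ 1ℝ - p
  0≤1-p {p} (inj₁ p<1) =
    inj₁ (subst (_< 1ℝ - p) (-‿inverseʳ p) (+-monoˡ-< (- p) p<1))
  0≤1-p {p} (inj₂ refl) = inj₂ (sym (-‿inverseʳ 1ℝ))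

  1-p≤1 : ∀ {p} → 0ℝ ≤ p → 1ℝ - p ≤ 1ℝ
  1-p≤1 {p} (inj₁ 0<p) =
    inj₁ (subst₂ _<_ (+-identityˡ (1ℝ - p)) (p+[1-p]≡1 p) (+-monoˡ-< (1ℝ - p) 0<p))
  1-p≤1 {p} (inj₂ refl) = inj₂ (trans (cong (1ℝ +_) -0≡0) (+-identityʳ 1ℝ))

  p+[1-p]≤1 : ∀ p → p + (1ℝ - p) ≤ 1ℝ
  p+[1-p]≤1 p = inj₂ (p+[1-p]≡1 p)

module Convex (R : RealNumbers) where
  open RealNumbers R

  -- Pointed convex algebra.  The operation +_p for p ∈ (0,1) is 'mix p';
  -- the proofs of 0 < p < 1 are irrelevant arguments.
  record PCA {ℓ : Level} (X : Set ℓ) : Set ℓ where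
    field
      ⋆   : X
      mix : (p : ℝ) → .(0ℝ < p) → .(p < 1ℝ) → X → X → X
      assoc : ∀ p q r s .(p₀ : 0ℝ < p) .(p₁ : p < 1ℝ) .(q₀ : 0ℝ < q) .(q₁ : q < 1ℝ)
                .(r₀ : 0ℝ < r) .(r₁ : r < 1ℝ) .(s₀ : 0ℝ < s) .(s₁ : s < 1ℝ) →
              r ≡ p * q → s * (1ℝ - p * q) ≡ p * (1ℝ - q) →
              ∀ x₁ x₂ x₃ →
              mix p p₀ p₁ (mix q q₀ q₁ x₁ x₂) x₃ ≡ mix r r₀ r₁ x₁ (mix s s₀ s₁ x₂ x₃)
      comm  : ∀ p .(p₀ : 0ℝ < p) .(p₁ : p < 1ℝ) .(q₀ : 0ℝ < 1ℝ - p) .(q₁ : 1ℝ - p < 1ℝ) →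
              ∀ x₁ x₂ → mix p p₀ p₁ x₁ x₂ ≡ mix (1ℝ - p) q₀ q₁ x₂ x₁
      idem  : ∀ p .(p₀ : 0ℝ < p) .(p₁ : p < 1ℝ) x → mix p p₀ p₁ x x ≡ x

    mixC : (p : ℝ) → 0ℝ ≤ p → p ≤ 1ℝ → X → X → X
    mixC p (inj₂ _)   _          x y = y
    mixC p (inj₁ _)   (inj₂ _)   x y = x
    mixC p (inj₁ p₀)  (inj₁ p₁)  x y = mix p p₀ p₁ x y

    scale : (p : ℝ) → 0ℝ ≤ p → p ≤ 1ℝ → X → X
    scale p p₀ p₁ x = mixC p p₀ p₁ x ⋆

  record Category (o ℓ : Level) : Set (lsuc (o ⊔ ℓ)) where
    infixr 9 _⨾_
    field
      Obj  : Set o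
      Hom  : Obj → Obj → Set ℓ
      id   : ∀ {A} → Hom A A
      _⨾_  : ∀ {A B C} → Hom A B → Hom B C → Hom A C
      identityˡ : ∀ {A B} (f : Hom A B) → id ⨾ f ≡ f
      identityʳ : ∀ {A B} (f : Hom A B) → f ⨾ id ≡ f
      assoc     : ∀ {A B C D} (f : Hom A B) (g : Hom B C) (h : Hom C D) →
                  (f ⨾ g) ⨾ h ≡ f ⨾ (g ⨾ h)

  record PCAEnriched (o ℓ : Level) : Set (lsuc (o ⊔ ℓ)) where
    field
      category : Category o ℓ
    open Category category public
    field
      pca : ∀ A B → PCA (Hom A B)

    ⋆ : ∀ {A B} → Hom A B
    ⋆ {A} {B} = PCA.⋆ (pca A B)

    mix : ∀ {A B} (p : ℝ) → .(0ℝ < p) → .(p < 1ℝ) → Hom A B → Hom A B → Hom A B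
    mix {A} {B} = PCA.mix (pca A B)

    mixC : ∀ {A B} (p : ℝ) → 0ℝ ≤ p → p ≤ 1ℝ → Hom A B → Hom A B → Hom A B
    mixC {A} {B} = PCA.mixC (pca A B)

    scale : ∀ {A B} (p : ℝ) → 0ℝ ≤ p → p ≤ 1ℝ → Hom A B → Hom A B
    scale {A} {B} = PCA.scale (pca A B)

    field
      ⨾-mixˡ : ∀ {A B C} (e : Hom A B) (f g : Hom B C) p .(p₀ : 0ℝ < p) .(p₁ : p < 1ℝ) →
               e ⨾ mix p p₀ p₁ f g ≡ mix p p₀ p₁ (e ⨾ f) (e ⨾ g)
      ⨾-mixʳ : ∀ {A B C} (f g : Hom A B) (h : Hom B C) p .(p₀ : 0ℝ < p) .(p₁ : p < 1ℝ) →
               mix p p₀ p₁ f g ⨾ h ≡ mix p p₀ p₁ (f ⨾ h) (g ⨾ h)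
      ⨾-⋆ : ∀ {A B C} (f : Hom A B) → f ⨾ ⋆ ≡ ⋆ {A} {C}
      ⋆-⨾ : ∀ {A B C} (f : Hom B C) → ⋆ ⨾ f ≡ ⋆ {A} {C}

  record ConvexBiproductCategory (o ℓ : Level) : Set (lsuc (o ⊔ ℓ)) where
    field
      enriched : PCAEnriched o ℓ
    open PCAEnriched enriched public
    infixr 6 _⊕_
    field
      𝟎 : Obj
      initial  : ∀ A → Σ (Hom 𝟎 A) λ h → ∀ h′ → h′ ≡ h
      terminal : ∀ A → Σ (Hom A 𝟎) λ h → ∀ h′ → h′ ≡ h
      _⊕_ : Obj → Obj → Obj
      π₁ : ∀ {X₁ X₂} → Hom (X₁ ⊕ X₂) X₁
      π₂ : ∀ {X₁ X₂} → Hom (X₁ ⊕ X₂) X₂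
      ι₁ : ∀ {X₁ X₂} → Hom X₁ (X₁ ⊕ X₂)
      ι₂ : ∀ {X₁ X₂} → Hom X₂ (X₁ ⊕ X₂)
      coproduct : ∀ {A X₁ X₂} (f₁ : Hom X₁ A) (f₂ : Hom X₂ A) →
                  Σ (Hom (X₁ ⊕ X₂) A) λ h →
                    (ι₁ ⨾ h ≡ f₁ × ι₂ ⨾ h ≡ f₂)
                  × (∀ h′ → ι₁ ⨾ h′ ≡ f₁ → ι₂ ⨾ h′ ≡ f₂ → h′ ≡ h)
      convexProduct : ∀ {A X₁ X₂} (p₁ p₂ : ℝ)
                  (a₁ : 0ℝ ≤ p₁) (b₁ : p₁ ≤ 1ℝ) (a₂ : 0ℝ ≤ p₂) (b₂ : p₂ ≤ 1ℝ) →
                  p₁ + p₂ ≤ 1ℝ →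
                  (f₁ : Hom A X₁) (f₂ : Hom A X₂) →
                  Σ (Hom A (X₁ ⊕ X₂)) λ h →
                    (h ⨾ π₁ ≡ scale p₁ a₁ b₁ f₁ × h ⨾ π₂ ≡ scale p₂ a₂ b₂ f₂)
                  × (∀ h′ → h′ ⨾ π₁ ≡ scale p₁ a₁ b₁ f₁ → h′ ⨾ π₂ ≡ scale p₂ a₂ b₂ f₂ → h′ ≡ h)
      ι₁⨾π₁ : ∀ {X₁ X₂} → ι₁ {X₁} {X₂} ⨾ π₁ ≡ id
      ι₂⨾π₂ : ∀ {X₁ X₂} → ι₂ {X₁} {X₂} ⨾ π₂ ≡ id
      ι₁⨾π₂ : ∀ {X₁ X₂} → ι₁ {X₁} {X₂} ⨾ π₂ ≡ ⋆
      ι₂⨾π₁ : ∀ {X₁ X₂} → ι₂ {X₁} {X₂} ⨾ π₁ ≡ ⋆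

    [_,_] : ∀ {A X₁ X₂} → Hom X₁ A → Hom X₂ A → Hom (X₁ ⊕ X₂) A
    [ f₁ , f₂ ] = proj₁ (coproduct f₁ f₂)

    ⟨_,_⟩[_,_] : ∀ {A X₁ X₂} (f₁ : Hom A X₁) (f₂ : Hom A X₂) (p₁ p₂ : ℝ)
                 {a₁ : 0ℝ ≤ p₁} {b₁ : p₁ ≤ 1ℝ} {a₂ : 0ℝ ≤ p₂} {b₂ : p₂ ≤ 1ℝ} →
                 p₁ + p₂ ≤ 1ℝ → Hom A (X₁ ⊕ X₂)
    ⟨ f₁ , f₂ ⟩[ p₁ , p₂ ] {a₁} {b₁} {a₂} {b₂} s =
      proj₁ (convexProduct p₁ p₂ a₁ b₁ a₂ b₂ s f₁ f₂)

-- The arrow h = (f ⨾ ι₁) +_p (g ⨾ ι₂) has projections f +_p ⋆ = p · f and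
-- ⋆ +_p g = (1 - p) · g, so by uniqueness it is ⟨f , g⟩_{p,1-p}; and
-- composing h with [id , id] gives (f ⨾ ι₁ ⨾ [id , id]) +_p (g ⨾ ι₂ ⨾ [id , id]) = f +_p g.
module Submission where

open import Defs
open import Relation.Binary.PropositionalEquality
  using (_≡_; refl; sym; trans; cong; cong₂; module ≡-Reasoning)
open import Data.Sum using (inj₁; inj₂)
open import Data.Product using (proj₁; proj₂)
open import Data.Empty using (⊥-elim)

module _ (R : RealNumbers) where
  open RealNumbers R
  open Convex R

  module _ {a} {X : Set a} (A : PCA X) where
    open PCA A

    mixC-comm : ∀ p (p₀ : 0ℝ ≤ p) (p₁ : p ≤ 1ℝ) x y →
                mixC p p₀ p₁ x y ≡ mixC (1ℝ - p) (0≤1-p p₁) (1-p≤1 p₀) y x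
    mixC-comm p (inj₂ refl) (inj₂ 0≡1) x y = ⊥-elim (0≢1 0≡1)
    mixC-comm p (inj₂ refl) (inj₁ _)   x y = refl
    mixC-comm p (inj₁ _)    (inj₂ refl) x y = refl
    mixC-comm p (inj₁ p₀)   (inj₁ p₁)  x y = comm p p₀ p₁ _ _ x y

  module _ {o ℓ} (𝐂 : Category o ℓ) where
    open Category 𝐂

    pullʳ : ∀ {A B C D} {f : Hom A B} {u : Hom B C} {v : Hom C D} {w : Hom B D} →
            u ⨾ v ≡ w → (f ⨾ u) ⨾ v ≡ f ⨾ w
    pullʳ {f = f} uv≡w = trans (assoc _ _ _) (cong (f ⨾_) uv≡w)

  module _ {o ℓ} (𝐂 : PCAEnriched o ℓ) where
    open PCAEnriched 𝐂

    mixC-⨾ : ∀ {A B C} p (p₀ : 0ℝ ≤ p) (p₁ : p ≤ 1ℝ)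
               (f g : Hom A B) (h : Hom B C) →
             mixC p p₀ p₁ f g ⨾ h ≡ mixC p p₀ p₁ (f ⨾ h) (g ⨾ h)
    mixC-⨾ p (inj₂ _)  _         f g h = refl
    mixC-⨾ p (inj₁ _)  (inj₂ _)  f g h = refl
    mixC-⨾ p (inj₁ p₀) (inj₁ p₁) f g h = ⨾-mixʳ f g h p p₀ p₁

  module _ {o ℓ} (𝐂 : ConvexBiproductCategory o ℓ) where
    open ConvexBiproductCategory 𝐂
    open ≡-Reasoning

    ι₁⨾[,] : ∀ {A X₁ X₂} (h₁ : Hom X₁ A) (h₂ : Hom X₂ A) → ι₁ ⨾ [ h₁ , h₂ ] ≡ h₁
    ι₁⨾[,] h₁ h₂ = proj₁ (proj₁ (proj₂ (coproduct h₁ h₂)))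

    ι₂⨾[,] : ∀ {A X₁ X₂} (h₁ : Hom X₁ A) (h₂ : Hom X₂ A) → ι₂ ⨾ [ h₁ , h₂ ] ≡ h₂
    ι₂⨾[,] h₁ h₂ = proj₂ (proj₁ (proj₂ (coproduct h₁ h₂)))

    ⟨,⟩≡mixC : ∀ {X Y₁ Y₂} (f : Hom X Y₁) (g : Hom X Y₂) p (p₀ : 0ℝ ≤ p) (p₁ : p ≤ 1ℝ) →
               ⟨ f , g ⟩[ p , 1ℝ - p ] {p₀} {p₁} {0≤1-p p₁} {1-p≤1 p₀} (p+[1-p]≤1 p)
                 ≡ mixC p p₀ p₁ (f ⨾ ι₁) (g ⨾ ι₂)
    ⟨,⟩≡mixC f g p p₀ p₁ = sym (unique _ mix⨾π₁ mix⨾π₂)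
      where
      unique = proj₂ (proj₂ (convexProduct p (1ℝ - p) p₀ p₁ (0≤1-p p₁) (1-p≤1 p₀)
                                           (p+[1-p]≤1 p) f g))

      mix⨾π₁ : mixC p p₀ p₁ (f ⨾ ι₁) (g ⨾ ι₂) ⨾ π₁ ≡ scale p p₀ p₁ f
      mix⨾π₁ = begin
        mixC p p₀ p₁ (f ⨾ ι₁) (g ⨾ ι₂) ⨾ π₁
          ≡⟨ mixC-⨾ enriched p p₀ p₁ _ _ π₁ ⟩
        mixC p p₀ p₁ ((f ⨾ ι₁) ⨾ π₁) ((g ⨾ ι₂) ⨾ π₁)
          ≡⟨ cong₂ (mixC p p₀ p₁)
                   (trans (pullʳ category ι₁⨾π₁) (identityʳ f))
                   (trans (pullʳ category ι₂⨾π₁) (⨾-⋆ g)) ⟩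
        mixC p p₀ p₁ f ⋆
          ∎

      mix⨾π₂ : mixC p p₀ p₁ (f ⨾ ι₁) (g ⨾ ι₂) ⨾ π₂
               ≡ scale (1ℝ - p) (0≤1-p p₁) (1-p≤1 p₀) g
      mix⨾π₂ = begin
        mixC p p₀ p₁ (f ⨾ ι₁) (g ⨾ ι₂) ⨾ π₂
          ≡⟨ mixC-⨾ enriched p p₀ p₁ _ _ π₂ ⟩
        mixC p p₀ p₁ ((f ⨾ ι₁) ⨾ π₂) ((g ⨾ ι₂) ⨾ π₂)
          ≡⟨ cong₂ (mixC p p₀ p₁)
                   (trans (pullʳ category ι₁⨾π₂) (⨾-⋆ f))
                   (trans (pullʳ category ι₂⨾π₂) (identityʳ g)) ⟩
        mixC p p₀ p₁ ⋆ g
          ≡⟨ mixC-comm (pca _ _) p p₀ p₁ ⋆ g ⟩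
        mixC (1ℝ - p) (0≤1-p p₁) (1-p≤1 p₀) g ⋆
          ∎

lemma1 : (R : RealNumbers) → let open RealNumbers R in
         ∀ {o ℓ} (𝐂 : Convex.ConvexBiproductCategory R o ℓ) →
         let open Convex.ConvexBiproductCategory 𝐂 in
         ∀ {X Y} (f g : Hom X Y) (p : ℝ) (p₀ : 0ℝ ≤ p) (p₁ : p ≤ 1ℝ) →
         mixC p p₀ p₁ f g
           ≡ ⟨ f , g ⟩[ p , 1ℝ - p ] {p₀} {p₁} {0≤1-p p₁} {1-p≤1 p₀} (p+[1-p]≤1 p)
             ⨾ [ id , id ]
lemma1 R 𝐂 f g p p₀ p₁ = sym (begin
  ⟨ f , g ⟩[ p , 1ℝ - p ] (p+[1-p]≤1 p) ⨾ [ id , id ]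
    ≡⟨ cong (_⨾ [ id , id ]) (⟨,⟩≡mixC R 𝐂 f g p p₀ p₁) ⟩
  mixC p p₀ p₁ (f ⨾ ι₁) (g ⨾ ι₂) ⨾ [ id , id ]
    ≡⟨ mixC-⨾ R enriched p p₀ p₁ _ _ [ id , id ] ⟩
  mixC p p₀ p₁ ((f ⨾ ι₁) ⨾ [ id , id ]) ((g ⨾ ι₂) ⨾ [ id , id ])
    ≡⟨ cong₂ (mixC p p₀ p₁)
             (trans (pullʳ R category (ι₁⨾[,] R 𝐂 id id)) (identityʳ f))
             (trans (pullʳ R category (ι₂⨾[,] R 𝐂 id id)) (identityʳ g)) ⟩
  mixC p p₀ p₁ f g
    ∎)
  where
  open RealNumbers R
  open Convex.ConvexBiproductCategory 𝐂
  open ≡-Reasoning
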